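{- Let $(\mathcal C,\otimes,I,\gamma)$ be a symmetric monoidal category and $\mathcal T$ a strong monad on it. If $(X,f:X\to\mathcal TY)$ is a central cone of $\mathcal T$ at $Y$, then for any morphism $g:Y\to Z$, the pair $(X,\mathcal Tg\circ f)$ is a central cone of $\mathcal T$ at $Z$.
   Context: $\mathcal T=(\mathcal T,\eta,\mu,\tau)$ with left strength $\tau_{X,Y}:X\otimes\mathcal TY\to\mathcal T(X\otimes Y)$ and right strength $\tau'_{X,Y}=\mathcal T(\gamma_{Y,X})\circ\tau_{Y,X}\circ\gamma_{\mathcal TX,Y}$. A central cone of $\mathcal T$ at an object $A$ is a pair $(W,\iota)$ with $\iota:W\to\mathcal TA$ such that for every object $B$, $\mu_{A\otimes B}\circ\mathcal T\tau'_{A,B}\circ\tau_{\mathcal TA,B}\circ(\iota\otimes\mathcal TB)=\mu_{A\otimes B}\circ\mathcal T\tau_{A,B}\circ\tau'_{A,\mathcal TB}\circ(\iota\otimes\mathcal TB)$ as morphisms $W\otimes\mathcal TB\to\mathcal T(A\otimes B)$. -}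

module Defs where

open import Level using (Level; _⊔_; suc)
open import Relation.Binary using (Rel; IsEquivalence)

record Category (o ℓ e : Level) : Set (suc (o ⊔ ℓ ⊔ e)) where
  infixr 9 _∘_
  infix  4 _≈_
  field
    Obj : Set o
    _⇒_ : Obj → Obj → Set ℓ
    _≈_ : ∀ {A B} → Rel (A ⇒ B) e
    id  : ∀ {A} → A ⇒ A
    _∘_ : ∀ {A B C} → B ⇒ C → A ⇒ B → A ⇒ C
    equiv     : ∀ {A B} → IsEquivalence (_≈_ {A} {B})
    assoc     : ∀ {A B C D} {f : A ⇒ B} {g : B ⇒ C} {h : C ⇒ D} →
                (h ∘ g) ∘ f ≈ h ∘ (g ∘ f)
    identityˡ : ∀ {A B} {f : A ⇒ B} → id ∘ f ≈ f
    identityʳ : ∀ {A B} {f : A ⇒ B} → f ∘ id ≈ f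
    ∘-resp-≈  : ∀ {A B C} {f h : B ⇒ C} {g i : A ⇒ B} →
                f ≈ h → g ≈ i → f ∘ g ≈ h ∘ i

record Endofunctor {o ℓ e} (C : Category o ℓ e) : Set (o ⊔ ℓ ⊔ e) where
  open Category C
  field
    F₀ : Obj → Obj
    F₁ : ∀ {A B} → A ⇒ B → F₀ A ⇒ F₀ B
    identity     : ∀ {A} → F₁ (id {A}) ≈ id
    homomorphism : ∀ {A B C} {f : A ⇒ B} {g : B ⇒ C} → F₁ (g ∘ f) ≈ F₁ g ∘ F₁ f
    F-resp-≈     : ∀ {A B} {f g : A ⇒ B} → f ≈ g → F₁ f ≈ F₁ g

record SymmetricMonoidal {o ℓ e} (C : Category o ℓ e) : Set (o ⊔ ℓ ⊔ e) where
  open Category C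
  infixr 10 _⊗₀_ _⊗₁_
  field
    _⊗₀_ : Obj → Obj → Obj
    _⊗₁_ : ∀ {A B X Y} → A ⇒ B → X ⇒ Y → (A ⊗₀ X) ⇒ (B ⊗₀ Y)
    ⊗-identity     : ∀ {A B} → (id {A} ⊗₁ id {B}) ≈ id
    ⊗-homomorphism : ∀ {A B C X Y Z} {f : A ⇒ B} {g : B ⇒ C} {h : X ⇒ Y} {k : Y ⇒ Z} →
                     ((g ∘ f) ⊗₁ (k ∘ h)) ≈ (g ⊗₁ k) ∘ (f ⊗₁ h)
    ⊗-resp-≈       : ∀ {A B X Y} {f g : A ⇒ B} {h k : X ⇒ Y} →
                     f ≈ g → h ≈ k → (f ⊗₁ h) ≈ (g ⊗₁ k)
    unit : Obj
    λ⇒ : ∀ {X} → (unit ⊗₀ X) ⇒ X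
    λ⇐ : ∀ {X} → X ⇒ (unit ⊗₀ X)
    λ-isoˡ : ∀ {X} → λ⇐ ∘ λ⇒ {X} ≈ id
    λ-isoʳ : ∀ {X} → λ⇒ ∘ λ⇐ {X} ≈ id
    λ-natural : ∀ {X Y} {f : X ⇒ Y} → f ∘ λ⇒ ≈ λ⇒ ∘ (id ⊗₁ f)
    ρ⇒ : ∀ {X} → (X ⊗₀ unit) ⇒ X
    ρ⇐ : ∀ {X} → X ⇒ (X ⊗₀ unit)
    ρ-isoˡ : ∀ {X} → ρ⇐ ∘ ρ⇒ {X} ≈ id
    ρ-isoʳ : ∀ {X} → ρ⇒ ∘ ρ⇐ {X} ≈ id
    ρ-natural : ∀ {X Y} {f : X ⇒ Y} → f ∘ ρ⇒ ≈ ρ⇒ ∘ (f ⊗₁ id)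
    α⇒ : ∀ {X Y Z} → ((X ⊗₀ Y) ⊗₀ Z) ⇒ (X ⊗₀ (Y ⊗₀ Z))
    α⇐ : ∀ {X Y Z} → (X ⊗₀ (Y ⊗₀ Z)) ⇒ ((X ⊗₀ Y) ⊗₀ Z)
    α-isoˡ : ∀ {X Y Z} → α⇐ ∘ α⇒ {X} {Y} {Z} ≈ id
    α-isoʳ : ∀ {X Y Z} → α⇒ ∘ α⇐ {X} {Y} {Z} ≈ id
    α-natural : ∀ {X X' Y Y' Z Z'} {f : X ⇒ X'} {g : Y ⇒ Y'} {h : Z ⇒ Z'} →
                (f ⊗₁ (g ⊗₁ h)) ∘ α⇒ ≈ α⇒ ∘ ((f ⊗₁ g) ⊗₁ h)
    triangle : ∀ {X Y} → (id {X} ⊗₁ λ⇒ {Y}) ∘ α⇒ ≈ (ρ⇒ ⊗₁ id)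
    pentagon : ∀ {W X Y Z} →
               (id {W} ⊗₁ α⇒ {X} {Y} {Z}) ∘ α⇒ ∘ (α⇒ ⊗₁ id) ≈ α⇒ ∘ α⇒
    γ : ∀ {X Y} → (X ⊗₀ Y) ⇒ (Y ⊗₀ X)
    γ-natural : ∀ {X X' Y Y'} {f : X ⇒ X'} {g : Y ⇒ Y'} →
                (g ⊗₁ f) ∘ γ ≈ γ ∘ (f ⊗₁ g)
    γ-involutive : ∀ {X Y} → γ {Y} {X} ∘ γ {X} {Y} ≈ id
    hexagon : ∀ {X Y Z} →
              (id {Y} ⊗₁ γ {X} {Z}) ∘ α⇒ ∘ (γ {X} {Y} ⊗₁ id) ≈ α⇒ ∘ γ {X} {Y ⊗₀ Z} ∘ α⇒

record StrongMonad {o ℓ e} {C : Category o ℓ e} (M : SymmetricMonoidal C) : Set (o ⊔ ℓ ⊔ e) where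
  open Category C
  open SymmetricMonoidal M
  field
    T : Endofunctor C
  open Endofunctor T public
  field
    η : ∀ {X} → X ⇒ F₀ X
    μ : ∀ {X} → F₀ (F₀ X) ⇒ F₀ X
    η-natural : ∀ {X Y} {f : X ⇒ Y} → η ∘ f ≈ F₁ f ∘ η
    μ-natural : ∀ {X Y} {f : X ⇒ Y} → μ ∘ F₁ (F₁ f) ≈ F₁ f ∘ μ
    μ-assoc     : ∀ {X} → μ {X} ∘ F₁ μ ≈ μ ∘ μ
    μ-identityˡ : ∀ {X} → μ {X} ∘ F₁ η ≈ id
    μ-identityʳ : ∀ {X} → μ {X} ∘ η ≈ id
    τ : ∀ {X Y} → (X ⊗₀ F₀ Y) ⇒ F₀ (X ⊗₀ Y)
    τ-natural : ∀ {X X' Y Y'} {f : X ⇒ X'} {g : Y ⇒ Y'} →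
                τ ∘ (f ⊗₁ F₁ g) ≈ F₁ (f ⊗₁ g) ∘ τ
    τ-unit  : ∀ {X} → F₁ λ⇒ ∘ τ {unit} {X} ≈ λ⇒
    τ-assoc : ∀ {X Y Z} →
              F₁ (α⇒ {X} {Y} {Z}) ∘ τ ≈ τ ∘ (id ⊗₁ τ) ∘ α⇒
    τ-η : ∀ {X Y} → τ ∘ (id {X} ⊗₁ η {Y}) ≈ η
    τ-μ : ∀ {X Y} → τ ∘ (id {X} ⊗₁ μ {Y}) ≈ μ ∘ F₁ τ ∘ τ

  τ' : ∀ {X Y} → (F₀ X ⊗₀ Y) ⇒ F₀ (X ⊗₀ Y)
  τ' {X} {Y} = F₁ (γ {Y} {X}) ∘ τ {Y} {X} ∘ γ {F₀ X} {Y}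

IsCentralCone : ∀ {o ℓ e} {C : Category o ℓ e} {M : SymmetricMonoidal C} →
                (S : StrongMonad M) → (A : Category.Obj C) → (W : Category.Obj C) →
                Category._⇒_ C W (StrongMonad.F₀ S A) → Set (o ⊔ e)
IsCentralCone {C = C} {M = M} S A W ι =
  ∀ (B : Obj) →
    μ {A ⊗₀ B} ∘ F₁ (τ' {A} {B}) ∘ τ {F₀ A} {B} ∘ (ι ⊗₁ id {F₀ B})
      ≈ μ {A ⊗₀ B} ∘ F₁ (τ {A} {B}) ∘ τ' {A} {F₀ B} ∘ (ι ⊗₁ id {F₀ B})
  where
    open Category C
    open SymmetricMonoidal M
    open StrongMonad S

{-# OPTIONS --safe #-}
-- Centrality of ι says that the double strengths dstrˡ = μ ∘ T τ' ∘ τ and dstrʳ = μ ∘ T τ ∘ τ'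
-- agree on ι ⊗ id. Both are natural in the first argument, being pasted from naturality squares of
-- τ, τ' and μ, so dstrˡ ∘ (T g ⊗ id) ∘ (f ⊗ id) = T (g ⊗ id) ∘ dstrˡ ∘ (f ⊗ id), likewise for dstrʳ,
-- and centrality of f identifies the right-hand sides.
module Submission where

open import Defs
open import Level using (Level)
open import Relation.Binary using (Setoid; IsEquivalence)
import Relation.Binary.Reasoning.Setoid as SetoidReasoning

module CategoryProperties {o ℓ e : Level} (C : Category o ℓ e) where
  open Category C

  module ≈ {A B : Obj} = IsEquivalence (equiv {A} {B})

  hom-setoid : Obj → Obj → Setoid ℓ e
  hom-setoid A B = record { Carrier = A ⇒ B ; _≈_ = _≈_ ; isEquivalence = equiv }

  module HomReasoning {A B : Obj} = SetoidReasoning (hom-setoid A B)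

  infixr 9 _⟩∘⟨_
  _⟩∘⟨_ : ∀ {A B D} {f h : B ⇒ D} {g i : A ⇒ B} → f ≈ h → g ≈ i → f ∘ g ≈ h ∘ i
  _⟩∘⟨_ = ∘-resp-≈

  assoc² : ∀ {A B D E F} {f : A ⇒ B} {g : B ⇒ D} {h : D ⇒ E} {k : E ⇒ F} →
           ((k ∘ h) ∘ g) ∘ f ≈ k ∘ h ∘ g ∘ f
  assoc² = ≈.trans assoc assoc

  glue : ∀ {A B D A' B' D'} {k : A ⇒ B} {k' : A' ⇒ B'} {l : B ⇒ D} {l' : B' ⇒ D'}
           {a : A ⇒ A'} {b : B ⇒ B'} {c : D ⇒ D'} →
         l' ∘ b ≈ c ∘ l → k' ∘ a ≈ b ∘ k → (l' ∘ k') ∘ a ≈ c ∘ (l ∘ k)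
  glue {k = k} {k'} {l} {l'} {a} {b} {c} outer inner = begin
    (l' ∘ k') ∘ a  ≈⟨ assoc ⟩
    l' ∘ k' ∘ a    ≈⟨ ≈.refl ⟩∘⟨ inner ⟩
    l' ∘ b ∘ k     ≈⟨ ≈.sym assoc ⟩
    (l' ∘ b) ∘ k   ≈⟨ outer ⟩∘⟨ ≈.refl ⟩
    (c ∘ l) ∘ k    ≈⟨ assoc ⟩
    c ∘ l ∘ k      ∎
    where open HomReasoning

  agree-along-squares : ∀ {W A A' B B'} {x : W ⇒ A} {a : A ⇒ A'} {b : B ⇒ B'}
                          {p q : A ⇒ B} {p' q' : A' ⇒ B'} →
                        p' ∘ a ≈ b ∘ p → q' ∘ a ≈ b ∘ q → p ∘ x ≈ q ∘ x →
                        p' ∘ a ∘ x ≈ q' ∘ a ∘ x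
  agree-along-squares {x = x} {a} {b} {p} {q} {p'} {q'} p-square q-square agree = begin
    p' ∘ a ∘ x    ≈⟨ ≈.sym assoc ⟩
    (p' ∘ a) ∘ x  ≈⟨ p-square ⟩∘⟨ ≈.refl ⟩
    (b ∘ p) ∘ x   ≈⟨ assoc ⟩
    b ∘ p ∘ x     ≈⟨ ≈.refl ⟩∘⟨ agree ⟩
    b ∘ q ∘ x     ≈⟨ ≈.sym assoc ⟩
    (b ∘ q) ∘ x   ≈⟨ ≈.sym q-square ⟩∘⟨ ≈.refl ⟩
    (q' ∘ a) ∘ x  ≈⟨ assoc ⟩
    q' ∘ a ∘ x    ∎
    where open HomReasoning

module EndofunctorProperties {o ℓ e : Level} {C : Category o ℓ e} (F : Endofunctor C) where
  open Category C
  open Endofunctor F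
  open CategoryProperties C

  F-square : ∀ {A B A' B'} {h : A ⇒ B} {h' : A' ⇒ B'} {a : A ⇒ A'} {b : B ⇒ B'} →
             h' ∘ a ≈ b ∘ h → F₁ h' ∘ F₁ a ≈ F₁ b ∘ F₁ h
  F-square square = ≈.trans (≈.sym homomorphism) (≈.trans (F-resp-≈ square) homomorphism)

module StrongMonadProperties {o ℓ e : Level} {C : Category o ℓ e} {M : SymmetricMonoidal C}
                             (S : StrongMonad M) where
  open Category C
  open SymmetricMonoidal M
  open StrongMonad S
  open CategoryProperties C
  open EndofunctorProperties T

  ⊗-homomorphismˡ : ∀ {A B D E} {f : A ⇒ B} {g : B ⇒ D} →
                    (g ∘ f) ⊗₁ id {E} ≈ (g ⊗₁ id) ∘ (f ⊗₁ id)
  ⊗-homomorphismˡ = ≈.trans (⊗-resp-≈ ≈.refl (≈.sym identityˡ)) ⊗-homomorphism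

  extend : ∀ {A B} → A ⇒ F₀ B → F₀ A ⇒ F₀ B
  extend v = μ ∘ F₁ v

  extend-square : ∀ {A B A' B'} {v : A ⇒ F₀ B} {v' : A' ⇒ F₀ B'} {a : A ⇒ A'} {b : B ⇒ B'} →
                  v' ∘ a ≈ F₁ b ∘ v → extend v' ∘ F₁ a ≈ F₁ b ∘ extend v
  extend-square square = glue μ-natural (F-square square)

  τ-naturalˡ : ∀ {A A' B} {f : A ⇒ A'} → τ ∘ (f ⊗₁ id) ≈ F₁ (f ⊗₁ id {B}) ∘ τ
  τ-naturalˡ = ≈.trans (≈.refl ⟩∘⟨ ⊗-resp-≈ ≈.refl (≈.sym identity)) τ-natural

  τ'-naturalˡ : ∀ {A A' B} {f : A ⇒ A'} → τ' ∘ (F₁ f ⊗₁ id) ≈ F₁ (f ⊗₁ id {B}) ∘ τ'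
  τ'-naturalˡ = glue (F-square (≈.sym γ-natural)) (glue τ-natural (≈.sym γ-natural))

  dstrˡ : ∀ {A B} → (F₀ A ⊗₀ F₀ B) ⇒ F₀ (A ⊗₀ B)
  dstrˡ = extend τ' ∘ τ

  dstrʳ : ∀ {A B} → (F₀ A ⊗₀ F₀ B) ⇒ F₀ (A ⊗₀ B)
  dstrʳ = extend τ ∘ τ'

  dstrˡ-naturalˡ : ∀ {A A' B} {f : A ⇒ A'} → dstrˡ ∘ (F₁ f ⊗₁ id) ≈ F₁ (f ⊗₁ id {B}) ∘ dstrˡ
  dstrˡ-naturalˡ = glue (extend-square τ'-naturalˡ) τ-naturalˡ

  dstrʳ-naturalˡ : ∀ {A A' B} {f : A ⇒ A'} → dstrʳ ∘ (F₁ f ⊗₁ id) ≈ F₁ (f ⊗₁ id {B}) ∘ dstrʳ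
  dstrʳ-naturalˡ = glue (extend-square τ-naturalˡ) τ'-naturalˡ

lemma2p8 : ∀ {o ℓ e : Level} {C : Category o ℓ e} {M : SymmetricMonoidal C}
           (S : StrongMonad M) {X Y Z : Category.Obj C}
           (f : Category._⇒_ C X (StrongMonad.F₀ S Y)) (g : Category._⇒_ C Y Z) →
           IsCentralCone S Y X f →
           IsCentralCone S Z X (Category._∘_ C (StrongMonad.F₁ S g) f)
lemma2p8 {C = C} {M} S f g central B = begin
  μ ∘ F₁ τ' ∘ τ ∘ ((F₁ g ∘ f) ⊗₁ id)    ≈⟨ ≈.sym assoc² ⟩
  dstrˡ ∘ ((F₁ g ∘ f) ⊗₁ id)            ≈⟨ ≈.refl ⟩∘⟨ ⊗-homomorphismˡ ⟩
  dstrˡ ∘ (F₁ g ⊗₁ id) ∘ (f ⊗₁ id)      ≈⟨ agree-along-squares dstrˡ-naturalˡ dstrʳ-naturalˡ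
                                             (≈.trans assoc² (≈.trans (central B) (≈.sym assoc²))) ⟩
  dstrʳ ∘ (F₁ g ⊗₁ id) ∘ (f ⊗₁ id)      ≈⟨ ≈.refl ⟩∘⟨ ≈.sym ⊗-homomorphismˡ ⟩
  dstrʳ ∘ ((F₁ g ∘ f) ⊗₁ id)            ≈⟨ assoc² ⟩
  μ ∘ F₁ τ ∘ τ' ∘ ((F₁ g ∘ f) ⊗₁ id)    ∎
  where
    open Category C
    open SymmetricMonoidal M
    open StrongMonad S
    open CategoryProperties C
    open HomReasoning
    open StrongMonadProperties S
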